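{- Let $G$ be a connected graph with $n$ vertices. Then $B(G)\ge\frac{n-1}{n}$, with equality if and only if $G$ is isomorphic to the complete graph $K_n$.
   Context: All graphs are finite, simple and undirected. The Laplacian matrix of $G$ is $L=D-A$ ($A$ adjacency matrix, $D$ diagonal degree matrix). $L^{+}$ is the Moore–Penrose inverse of $L$ and $L^{2+}=(L^{+})^2$. The biharmonic distance is the nonnegative number $d_B(u,v)$ with $d_B^2(u,v)=L^{2+}_{uu}+L^{2+}_{vv}-2L^{2+}_{uv}$, and the biharmonic index is $B(G)=\frac12\sum_{u\in V(G)}\sum_{v\in V(G)}d_B^2(u,v)$. -}

module Defs where

open import Data.Nat using (ℕ; zero; suc)
open import Data.Fin using (Fin; zero; suc; _≟_)
open import Data.Bool using (Bool; true; false; if_then_else_; not)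
open import Data.Rational using (ℚ; 0ℚ; 1ℚ; ½; _+_; _*_; _-_; -_)
open import Data.Product using (Σ-syntax; _×_)
open import Relation.Nullary using (does)
open import Relation.Binary.PropositionalEquality using (_≡_)
open import Function.Bundles using (_⤖_; Bijection)

Σ[_] : (n : ℕ) → (Fin n → ℚ) → ℚ
Σ[ zero ] f = 0ℚ
Σ[ suc n ] f = f zero + Σ[ n ] (λ i → f (suc i))

record Graph (n : ℕ) : Set where
  field
    adj     : Fin n → Fin n → Bool
    adj-sym : ∀ u v → adj u v ≡ adj v u
    irrefl  : ∀ u → adj u u ≡ false
open Graph public

data Reach {n : ℕ} (G : Graph n) (u : Fin n) : Fin n → Set where
  here : Reach G u u
  step : ∀ {v w} → Reach G u v → adj G v w ≡ true → Reach G u w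

Connected : {n : ℕ} → Graph n → Set
Connected G = ∀ u v → Reach G u v

complete : (n : ℕ) → Graph n
complete n = record { adj = λ u v → not (does (u ≟ v)) ; adj-sym = sym' ; irrefl = irr }
  where
  open import Relation.Nullary using (yes; no)
  open import Relation.Binary.PropositionalEquality using (refl; sym)
  open import Data.Empty using (⊥-elim)
  sym' : ∀ u v → not (does (u ≟ v)) ≡ not (does (v ≟ u))
  sym' u v with u ≟ v | v ≟ u
  ... | yes _ | yes _ = refl
  ... | no _ | no _ = refl
  ... | yes p | no q = ⊥-elim (q (sym p))
  ... | no p | yes q = ⊥-elim (p (sym q))
  irr : ∀ u → not (does (u ≟ u)) ≡ false
  irr u with u ≟ u
  ... | yes _ = refl
  ... | no p = ⊥-elim (p refl)

_≅_ : {n : ℕ} → Graph n → Graph n → Set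
_≅_ {n} G H = Σ[ f ∈ Fin n ⤖ Fin n ]
  (∀ u v → adj H (Bijection.to f u) (Bijection.to f v) ≡ adj G u v)

Matrix : ℕ → Set
Matrix n = Fin n → Fin n → ℚ

infixl 7 _⊗_
infix 4 _≐_
_⊗_ : {n : ℕ} → Matrix n → Matrix n → Matrix n
_⊗_ {n} A B i j = Σ[ n ] (λ k → A i k * B k j)

_ᵀ : {n : ℕ} → Matrix n → Matrix n
(A ᵀ) i j = A j i

_≐_ : {n : ℕ} → Matrix n → Matrix n → Set
A ≐ B = ∀ i j → A i j ≡ B i j

-- Moore–Penrose inverse (four Penrose equations; real matrices, so * = ᵀ)
IsMPInverse : {n : ℕ} → Matrix n → Matrix n → Set
IsMPInverse A X =
  ((A ⊗ X) ⊗ A ≐ A) × ((X ⊗ A) ⊗ X ≐ X) ×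
  (((A ⊗ X) ᵀ) ≐ (A ⊗ X)) × (((X ⊗ A) ᵀ) ≐ (X ⊗ A))

bit : Bool → ℚ
bit b = if b then 1ℚ else 0ℚ

degree : {n : ℕ} → Graph n → Fin n → ℚ
degree {n} G u = Σ[ n ] (λ v → bit (adj G u v))

laplacian : {n : ℕ} → Graph n → Matrix n
laplacian G i j = (if does (i ≟ j) then degree G i else 0ℚ) - bit (adj G i j)

-- Squared biharmonic distance, given L⁺ = X (so L^{2+} = X ⊗ X)
dB² : {n : ℕ} → Matrix n → Fin n → Fin n → ℚ
dB² X u v = let L2 = X ⊗ X in L2 u u + L2 v v - (1ℚ + 1ℚ) * L2 u v

-- Biharmonic index B(G), given L⁺ = X
biharmonicIndex : {n : ℕ} → Matrix n → ℚ
biharmonicIndex {n} X = ½ * Σ[ n ] (λ u → Σ[ n ] (λ v → dB² X u v))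

{-# OPTIONS --safe #-}
-- With X = L⁺ and P = I − J/n, connectivity (ker L = constants) forces L X = X L = P, so X is
-- symmetric with zero row sums and B(G) = n ‖X‖², where ‖·‖ is the Frobenius norm. Writing
-- R(u,v) = X_uu + X_vv − 2 X_uv for the effective resistance, Σ_{u,v} R(u,v) = 2n tr X, and by
-- Foster's theorem the resistances across the edges sum to n − 1. Expanding ‖X − P/n‖² gives
--   B(G) = (n − 1)/n + n ‖X − P/n‖² + (1/n) Σ R(u,v)   (ordered pairs u ≠ v with uv ∉ E).
-- Both corrections are nonnegative, and as R(u,v) > 0 for u ≠ v the last one vanishes only when
-- G is complete; conversely for K_n one has L = nP, hence X = P/n and both corrections vanish.

module Submission where

open import Defs
open import Data.Nat as ℕ using (ℕ; NonZero; _∸_; zero; suc)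
import Data.Integer as ℤ
open import Data.Rational
  using (ℚ; _≤_; _/_; 0ℚ; 1ℚ; ½; _+_; _*_; _-_; -_; 1/_; toℚᵘ; Positive; nonNegative; nonPositive; positive; negative)
  renaming (NonZero to NonZeroℚ)
import Data.Rational.Properties as ℚ
import Data.Rational.Unnormalised as ℚᵘ
import Data.Rational.Unnormalised.Properties as ℚᵘ
open import Data.Fin using (Fin; zero; suc; _≟_)
open import Data.Bool using (true; false; if_then_else_; not; _∧_)
open import Data.Product using (_×_; _,_; proj₁; proj₂)
open import Data.Sum using (inj₁; inj₂)
open import Data.Empty using (⊥-elim)
open import Relation.Nullary using (does; yes; no)
open import Relation.Binary.Definitions using (tri<; tri≈; tri>)
open import Relation.Binary.PropositionalEquality
open import Data.Maybe using (Maybe; just; nothing)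
open import Tactic.RingSolver using (solve-∀)
open import Data.Integer.Tactic.RingSolver using () renaming (solve-∀ to ℤ-solve-∀)
open import Tactic.RingSolver.Core.AlmostCommutativeRing using (AlmostCommutativeRing; fromCommutativeRing)
open import Algebra.Bundles using (Ring)
open import Algebra.Properties.Semiring.Sum (Ring.semiring ℚ.+-*-ring)
  using (sum; sum-cong-≗; ∑-distrib-+; ∑-comm; *-distribˡ-sum; sum-replicate)
open import Algebra.Properties.Semiring.Mult (Ring.semiring ℚ.+-*-ring) using (×-assoc-*) renaming (_×_ to _·_)
open import Algebra.Properties.Group ℚ.+-0-group using (x∙y⁻¹≈ε⇒x≈y; identityʳ-unique)
open import Algebra.Properties.Ring ℚ.+-*-ring using (-1*x≈-x)
open import Level using (0ℓ)
open import Function.Bundles using (Bijection; _⇔_; mk⇔)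
open import Function.Construct.Identity using (⤖-id)

ℚ-ring : AlmostCommutativeRing 0ℓ 0ℓ
ℚ-ring = fromCommutativeRing ℚ.+-*-commutativeRing isZero
  where
  isZero : (p : ℚ) → Maybe (0ℚ ≡ p)
  isZero p with 0ℚ ℚ.≟ p
  ... | yes 0≡p = just 0≡p
  ... | no _    = nothing

*-nonNeg : ∀ {x y} → 0ℚ ≤ x → 0ℚ ≤ y → 0ℚ ≤ x * y
*-nonNeg {x} {y} 0≤x 0≤y =
  ℚ.nonNegative⁻¹ (x * y) {{ℚ.nonNeg*nonNeg⇒nonNeg x {{nonNegative 0≤x}} y {{nonNegative 0≤y}}}}

x*x-nonNeg : ∀ x → 0ℚ ≤ x * x
x*x-nonNeg x with ℚ.≤-total 0ℚ x
... | inj₁ 0≤x = *-nonNeg 0≤x 0≤x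
... | inj₂ x≤0 =
  ℚ.nonNegative⁻¹ (x * x) {{ℚ.nonPos*nonPos⇒nonPos x {{nonPositive x≤0}} x {{nonPositive x≤0}}}}

x*x≡0⇒x≡0 : ∀ {x} → x * x ≡ 0ℚ → x ≡ 0ℚ
x*x≡0⇒x≡0 {x} x*x≡0 with ℚ.<-cmp x 0ℚ
... | tri≈ _ x≡0 _ = x≡0
... | tri< x<0 _ _ =
  ⊥-elim (ℚ.<-irrefl (sym x*x≡0) (ℚ.positive⁻¹ (x * x) {{ℚ.neg*neg⇒pos x {{negative x<0}} x {{negative x<0}}}}))
... | tri> _ _ x>0 =
  ⊥-elim (ℚ.<-irrefl (sym x*x≡0) (ℚ.positive⁻¹ (x * x) {{ℚ.pos*pos⇒pos x {{positive x>0}} x {{positive x>0}}}}))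

+-nonNeg : ∀ {x y} → 0ℚ ≤ x → 0ℚ ≤ y → 0ℚ ≤ x + y
+-nonNeg = ℚ.+-mono-≤

+-nonNeg-≡0ˡ : ∀ {x y} → 0ℚ ≤ x → 0ℚ ≤ y → x + y ≡ 0ℚ → x ≡ 0ℚ
+-nonNeg-≡0ˡ {x} {y} 0≤x 0≤y x+y≡0 = ℚ.≤-antisym x≤0 0≤x
  where
  x≤0 : x ≤ 0ℚ
  x≤0 = subst₂ _≤_ (ℚ.+-identityʳ x) x+y≡0 (ℚ.+-monoʳ-≤ x 0≤y)

+-nonNeg-≡0ʳ : ∀ {x y} → 0ℚ ≤ x → 0ℚ ≤ y → x + y ≡ 0ℚ → y ≡ 0ℚ
+-nonNeg-≡0ʳ {x} {y} 0≤x 0≤y x+y≡0 = +-nonNeg-≡0ˡ 0≤y 0≤x (trans (ℚ.+-comm y x) x+y≡0)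

x-y≡0⇒x≡y : ∀ {x y} → x - y ≡ 0ℚ → x ≡ y
x-y≡0⇒x≡y = x∙y⁻¹≈ε⇒x≈y _ _

bit-nonNeg : ∀ b → 0ℚ ≤ bit b
bit-nonNeg true  = ℚ.nonNegative⁻¹ 1ℚ
bit-nonNeg false = ℚ.≤-refl

·1-nonNeg : ∀ k → 0ℚ ≤ k · 1ℚ
·1-nonNeg zero    = ℚ.≤-refl
·1-nonNeg (suc k) = +-nonNeg (bit-nonNeg true) (·1-nonNeg k)

toℚᵘ-·1 : ∀ k → toℚᵘ (k · 1ℚ) ℚᵘ.≃ ℚᵘ.mkℚᵘ (ℤ.+ k) 0
toℚᵘ-·1 zero    = ℚᵘ.*≡* refl
toℚᵘ-·1 (suc k) = ℚᵘ.≃-trans (ℚ.toℚᵘ-homo-+ 1ℚ (k · 1ℚ))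
  (ℚᵘ.≃-trans (ℚᵘ.+-congʳ (toℚᵘ 1ℚ) (toℚᵘ-·1 k)) (ℚᵘ.*≡* (cross (ℤ.+ k))))
  where
  cross : ∀ z → (ℤ.+ 1 ℤ.* ℤ.+ 1 ℤ.+ z ℤ.* ℤ.+ 1) ℤ.* ℤ.+ 1 ≡ (ℤ.+ 1 ℤ.+ z) ℤ.* (ℤ.+ 1 ℤ.* ℤ.+ 1)
  cross = ℤ-solve-∀

Σ≡sum : ∀ {n} (f : Fin n → ℚ) → Σ[ n ] f ≡ sum f
Σ≡sum {zero}  f = refl
Σ≡sum {suc n} f = cong (f zero +_) (Σ≡sum (λ i → f (suc i)))

Σ-cong : ∀ {n} {f g : Fin n → ℚ} → (∀ i → f i ≡ g i) → Σ[ n ] f ≡ Σ[ n ] g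
Σ-cong {f = f} {g} f≗g = trans (Σ≡sum f) (trans (sum-cong-≗ f≗g) (sym (Σ≡sum g)))

Σ-const : ∀ {n} c → Σ[ n ] (λ _ → c) ≡ (n · 1ℚ) * c
Σ-const {n} c = begin
  Σ[ n ] (λ _ → c)    ≡⟨ Σ≡sum {n} (λ _ → c) ⟩
  sum {n} (λ _ → c)   ≡⟨ sum-replicate n {c} ⟩
  n · c               ≡⟨ cong (n ·_) (ℚ.*-identityˡ c) ⟨
  n · (1ℚ * c)        ≡⟨ ×-assoc-* n 1ℚ c ⟨
  (n · 1ℚ) * c        ∎
  where open ≡-Reasoning

Σ-zero : ∀ {n} → Σ[ n ] (λ _ → 0ℚ) ≡ 0ℚ
Σ-zero {n} = trans (Σ-const {n} 0ℚ) (ℚ.*-zeroʳ (n · 1ℚ))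

Σ-distrib-+ : ∀ {n} (f g : Fin n → ℚ) → Σ[ n ] (λ i → f i + g i) ≡ Σ[ n ] f + Σ[ n ] g
Σ-distrib-+ {n} f g = begin
  Σ[ n ] (λ i → f i + g i)  ≡⟨ Σ≡sum (λ i → f i + g i) ⟩
  sum (λ i → f i + g i)     ≡⟨ ∑-distrib-+ f g ⟩
  sum f + sum g             ≡⟨ cong₂ _+_ (Σ≡sum f) (Σ≡sum g) ⟨
  Σ[ n ] f + Σ[ n ] g       ∎
  where open ≡-Reasoning

*-distribˡ-Σ : ∀ {n} c (f : Fin n → ℚ) → c * Σ[ n ] f ≡ Σ[ n ] (λ i → c * f i)
*-distribˡ-Σ {n} c f = begin
  c * Σ[ n ] f              ≡⟨ cong (c *_) (Σ≡sum f) ⟩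
  c * sum f                 ≡⟨ *-distribˡ-sum c f ⟩
  sum (λ i → c * f i)       ≡⟨ Σ≡sum (λ i → c * f i) ⟨
  Σ[ n ] (λ i → c * f i)    ∎
  where open ≡-Reasoning

*-distribʳ-Σ : ∀ {n} c (f : Fin n → ℚ) → Σ[ n ] f * c ≡ Σ[ n ] (λ i → f i * c)
*-distribʳ-Σ {n} c f = begin
  Σ[ n ] f * c              ≡⟨ ℚ.*-comm (Σ[ n ] f) c ⟩
  c * Σ[ n ] f              ≡⟨ *-distribˡ-Σ c f ⟩
  Σ[ n ] (λ i → c * f i)    ≡⟨ Σ-cong (λ i → ℚ.*-comm c (f i)) ⟩
  Σ[ n ] (λ i → f i * c)    ∎
  where open ≡-Reasoning

Σ-distrib-- : ∀ {n} (f g : Fin n → ℚ) → Σ[ n ] (λ i → f i - g i) ≡ Σ[ n ] f - Σ[ n ] g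
Σ-distrib-- {n} f g = begin
  Σ[ n ] (λ i → f i - g i)          ≡⟨ Σ-distrib-+ f (λ i → - g i) ⟩
  Σ[ n ] f + Σ[ n ] (λ i → - g i)   ≡⟨ cong (Σ[ n ] f +_) Σ-neg ⟩
  Σ[ n ] f - Σ[ n ] g               ∎
  where
  open ≡-Reasoning
  Σ-neg : Σ[ n ] (λ i → - g i) ≡ - Σ[ n ] g
  Σ-neg = trans (Σ-cong (λ i → sym (-1*x≈-x (g i))))
                (trans (sym (*-distribˡ-Σ (- 1ℚ) g)) (-1*x≈-x (Σ[ n ] g)))

Σ-distrib-+- : ∀ {n} (f g h : Fin n → ℚ) →
  Σ[ n ] (λ i → f i - g i + h i) ≡ Σ[ n ] f - Σ[ n ] g + Σ[ n ] h
Σ-distrib-+- {n} f g h = trans (Σ-distrib-+ (λ i → f i - g i) h) (cong (_+ Σ[ n ] h) (Σ-distrib-- f g))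

Σ-comm : ∀ {m n} (f : Fin m → Fin n → ℚ) →
  Σ[ m ] (λ i → Σ[ n ] (λ j → f i j)) ≡ Σ[ n ] (λ j → Σ[ m ] (λ i → f i j))
Σ-comm {m} {n} f = begin
  Σ[ m ] (λ i → Σ[ n ] (f i))                ≡⟨ Σ≡sum (λ i → Σ[ n ] (f i)) ⟩
  sum (λ i → Σ[ n ] (f i))                   ≡⟨ sum-cong-≗ (λ i → Σ≡sum (f i)) ⟩
  sum (λ i → sum (f i))                      ≡⟨ ∑-comm f ⟩
  sum (λ j → sum (λ i → f i j))              ≡⟨ sum-cong-≗ (λ j → Σ≡sum (λ i → f i j)) ⟨
  sum (λ j → Σ[ m ] (λ i → f i j))           ≡⟨ Σ≡sum (λ j → Σ[ m ] (λ i → f i j)) ⟨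
  Σ[ n ] (λ j → Σ[ m ] (λ i → f i j))        ∎
  where open ≡-Reasoning

Σ-nonNeg : ∀ {n} {f : Fin n → ℚ} → (∀ i → 0ℚ ≤ f i) → 0ℚ ≤ Σ[ n ] f
Σ-nonNeg {zero}  0≤f = ℚ.≤-refl
Σ-nonNeg {suc n} 0≤f = +-nonNeg (0≤f zero) (Σ-nonNeg (λ i → 0≤f (suc i)))

Σ-nonNeg-≡0 : ∀ {n} {f : Fin n → ℚ} → (∀ i → 0ℚ ≤ f i) → Σ[ n ] f ≡ 0ℚ → ∀ i → f i ≡ 0ℚ
Σ-nonNeg-≡0 {suc n} 0≤f Σf≡0 zero =
  +-nonNeg-≡0ˡ (0≤f zero) (Σ-nonNeg (λ i → 0≤f (suc i))) Σf≡0
Σ-nonNeg-≡0 {suc n} 0≤f Σf≡0 (suc i) =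
  Σ-nonNeg-≡0 (λ i → 0≤f (suc i)) (+-nonNeg-≡0ʳ (0≤f zero) (Σ-nonNeg (λ i → 0≤f (suc i))) Σf≡0) i

ΣΣ-nonNeg-≡0 : ∀ {m n} {f : Fin m → Fin n → ℚ} → (∀ i j → 0ℚ ≤ f i j) →
  Σ[ m ] (λ i → Σ[ n ] (f i)) ≡ 0ℚ → ∀ i j → f i j ≡ 0ℚ
ΣΣ-nonNeg-≡0 0≤f ΣΣf≡0 i = Σ-nonNeg-≡0 (0≤f i) (Σ-nonNeg-≡0 (λ i → Σ-nonNeg (0≤f i)) ΣΣf≡0 i)

Σ-select : ∀ {n} (i : Fin n) (f : Fin n → ℚ) → Σ[ n ] (λ j → if does (i ≟ j) then f j else 0ℚ) ≡ f i
Σ-select {suc n} zero    f = trans (cong (f zero +_) (Σ-zero {n})) (ℚ.+-identityʳ (f zero))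
Σ-select {suc n} (suc i) f = trans (ℚ.+-identityˡ _) (Σ-select i (λ j → f (suc j)))

*-bit : ∀ b x → x * bit b ≡ (if b then x else 0ℚ)
*-bit true  x = ℚ.*-identityʳ x
*-bit false x = ℚ.*-zeroʳ x

I : ∀ {n} → Matrix n
I i j = bit (does (i ≟ j))

I-diag : ∀ {n} (i : Fin n) → I i i ≡ 1ℚ
I-diag i with i ≟ i
... | yes _   = refl
... | no i≢i = ⊥-elim (i≢i refl)

I-offDiag : ∀ {n} {i j : Fin n} → i ≢ j → I i j ≡ 0ℚ
I-offDiag {i = i} {j} i≢j with i ≟ j
... | yes i≡j = ⊥-elim (i≢j i≡j)
... | no _    = refl

I-sym : ∀ {n} (i j : Fin n) → I i j ≡ I j i
I-sym i j with i ≟ j | j ≟ i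
... | yes _   | yes _   = refl
... | no _    | no _    = refl
... | yes i≡j | no j≢i = ⊥-elim (j≢i (sym i≡j))
... | no i≢j  | yes j≡i = ⊥-elim (i≢j (sym j≡i))

Σ-*I : ∀ {n} (i : Fin n) (f : Fin n → ℚ) → Σ[ n ] (λ j → f j * I i j) ≡ f i
Σ-*I i f = trans (Σ-cong (λ j → *-bit (does (i ≟ j)) (f j))) (Σ-select i f)

Σ-*Iᵀ : ∀ {n} (j : Fin n) (f : Fin n → ℚ) → Σ[ n ] (λ k → f k * I k j) ≡ f j
Σ-*Iᵀ j f = trans (Σ-cong (λ k → cong (f k *_) (I-sym k j))) (Σ-*I j f)

Σ-I : ∀ {n} (i : Fin n) → Σ[ n ] (I i) ≡ 1ℚ
Σ-I i = trans (Σ-cong (λ j → sym (ℚ.*-identityˡ (I i j)))) (Σ-*I i (λ _ → 1ℚ))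

Symmetric : ∀ {n} → Matrix n → Set
Symmetric M = ∀ i j → M i j ≡ M j i

RowSumsZero : ∀ {n} → Matrix n → Set
RowSumsZero {n} M = ∀ i → Σ[ n ] (M i) ≡ 0ℚ

ColSumsZero : ∀ {n} → Matrix n → Set
ColSumsZero {n} M = ∀ j → Σ[ n ] (λ i → M i j) ≡ 0ℚ

trace : ∀ {n} → Matrix n → ℚ
trace {n} M = Σ[ n ] (λ i → M i i)

⊗-cong : ∀ {n} {A A′ B B′ : Matrix n} → A ≐ A′ → B ≐ B′ → A ⊗ B ≐ A′ ⊗ B′
⊗-cong A≐A′ B≐B′ i j = Σ-cong (λ k → cong₂ _*_ (A≐A′ i k) (B≐B′ k j))

⊗-assoc : ∀ {n} (A B C : Matrix n) → (A ⊗ B) ⊗ C ≐ A ⊗ (B ⊗ C)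
⊗-assoc {n} A B C i j = begin
  Σ[ n ] (λ k → Σ[ n ] (λ l → A i l * B l k) * C k j)
    ≡⟨ Σ-cong (λ k → *-distribʳ-Σ (C k j) (λ l → A i l * B l k)) ⟩
  Σ[ n ] (λ k → Σ[ n ] (λ l → A i l * B l k * C k j))
    ≡⟨ Σ-comm (λ k l → A i l * B l k * C k j) ⟩
  Σ[ n ] (λ l → Σ[ n ] (λ k → A i l * B l k * C k j))
    ≡⟨ Σ-cong (λ l → Σ-cong (λ k → ℚ.*-assoc (A i l) (B l k) (C k j))) ⟩
  Σ[ n ] (λ l → Σ[ n ] (λ k → A i l * (B l k * C k j)))
    ≡⟨ Σ-cong (λ l → *-distribˡ-Σ (A i l) (λ k → B l k * C k j)) ⟨
  Σ[ n ] (λ l → A i l * Σ[ n ] (λ k → B l k * C k j))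
    ∎
  where open ≡-Reasoning

⊗-rowSumsZero : ∀ {n} (A B : Matrix n) → RowSumsZero B → RowSumsZero (A ⊗ B)
⊗-rowSumsZero {n} A B ΣB≡0 i = begin
  Σ[ n ] (λ j → Σ[ n ] (λ k → A i k * B k j))  ≡⟨ Σ-comm (λ j k → A i k * B k j) ⟩
  Σ[ n ] (λ k → Σ[ n ] (λ j → A i k * B k j))  ≡⟨ Σ-cong (λ k → *-distribˡ-Σ (A i k) (B k)) ⟨
  Σ[ n ] (λ k → A i k * Σ[ n ] (B k))          ≡⟨ Σ-cong (λ k → trans (cong (A i k *_) (ΣB≡0 k)) (ℚ.*-zeroʳ (A i k))) ⟩
  Σ[ n ] (λ _ → 0ℚ)                            ≡⟨ Σ-zero {n} ⟩
  0ℚ                                           ∎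
  where open ≡-Reasoning

⊗-colSumsZero : ∀ {n} (A B : Matrix n) → ColSumsZero A → ColSumsZero (A ⊗ B)
⊗-colSumsZero {n} A B ΣA≡0 j = begin
  Σ[ n ] (λ i → Σ[ n ] (λ k → A i k * B k j))  ≡⟨ Σ-comm (λ i k → A i k * B k j) ⟩
  Σ[ n ] (λ k → Σ[ n ] (λ i → A i k * B k j))  ≡⟨ Σ-cong (λ k → *-distribʳ-Σ (B k j) (λ i → A i k)) ⟨
  Σ[ n ] (λ k → Σ[ n ] (λ i → A i k) * B k j)  ≡⟨ Σ-cong (λ k → trans (cong (_* B k j) (ΣA≡0 k)) (ℚ.*-zeroˡ (B k j))) ⟩
  Σ[ n ] (λ _ → 0ℚ)                            ≡⟨ Σ-zero {n} ⟩
  0ℚ                                           ∎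
  where open ≡-Reasoning

symmetric-rowSumsZero⇒colSumsZero : ∀ {n} {M : Matrix n} → Symmetric M → RowSumsZero M → ColSumsZero M
symmetric-rowSumsZero⇒colSumsZero M-sym ΣM≡0 j = trans (Σ-cong (λ i → M-sym i j)) (ΣM≡0 j)

gramDistance : ∀ {n} → Matrix n → Fin n → Fin n → ℚ
gramDistance M u v = M u u + M v v - (1ℚ + 1ℚ) * M u v

Σ-gramDistance : ∀ {n} (M : Matrix n) → RowSumsZero M →
  Σ[ n ] (λ u → Σ[ n ] (gramDistance M u)) ≡ (1ℚ + 1ℚ) * ((n · 1ℚ) * trace M)
Σ-gramDistance {n} M ΣM≡0 = begin
  Σ[ n ] (λ u → Σ[ n ] (gramDistance M u))         ≡⟨ Σ-cong row ⟩
  Σ[ n ] (λ u → (n · 1ℚ) * M u u + trace M)         ≡⟨ Σ-distrib-+ (λ u → (n · 1ℚ) * M u u) (λ _ → trace M) ⟩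
  Σ[ n ] (λ u → (n · 1ℚ) * M u u) + Σ[ n ] (λ _ → trace M)
    ≡⟨ cong₂ _+_ (sym (*-distribˡ-Σ (n · 1ℚ) (λ u → M u u))) (Σ-const {n} (trace M)) ⟩
  (n · 1ℚ) * trace M + (n · 1ℚ) * trace M          ≡⟨ double ((n · 1ℚ) * trace M) ⟩
  (1ℚ + 1ℚ) * ((n · 1ℚ) * trace M)                 ∎
  where
  open ≡-Reasoning
  double : ∀ x → x + x ≡ (1ℚ + 1ℚ) * x
  double = solve-∀ ℚ-ring
  drop-zero : ∀ x y → x + y - (1ℚ + 1ℚ) * 0ℚ ≡ x + y
  drop-zero = solve-∀ ℚ-ring
  row : ∀ u → Σ[ n ] (gramDistance M u) ≡ (n · 1ℚ) * M u u + trace M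
  row u = begin
    Σ[ n ] (λ v → M u u + M v v - (1ℚ + 1ℚ) * M u v)
      ≡⟨ Σ-distrib-- (λ v → M u u + M v v) (λ v → (1ℚ + 1ℚ) * M u v) ⟩
    Σ[ n ] (λ v → M u u + M v v) - Σ[ n ] (λ v → (1ℚ + 1ℚ) * M u v)
      ≡⟨ cong₂ _-_ (Σ-distrib-+ (λ _ → M u u) (λ v → M v v)) (sym (*-distribˡ-Σ (1ℚ + 1ℚ) (M u))) ⟩
    Σ[ n ] (λ _ → M u u) + trace M - (1ℚ + 1ℚ) * Σ[ n ] (M u)
      ≡⟨ cong₂ (λ a b → a + trace M - (1ℚ + 1ℚ) * b) (Σ-const {n} (M u u)) (ΣM≡0 u) ⟩
    (n · 1ℚ) * M u u + trace M - (1ℚ + 1ℚ) * 0ℚ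
      ≡⟨ drop-zero ((n · 1ℚ) * M u u) (trace M) ⟩
    (n · 1ℚ) * M u u + trace M
      ∎

sqNorm : ∀ {n} → Matrix n → ℚ
sqNorm {n} M = Σ[ n ] (λ i → Σ[ n ] (λ j → M i j * M i j))

sqNorm-nonNeg : ∀ {n} (M : Matrix n) → 0ℚ ≤ sqNorm M
sqNorm-nonNeg M = Σ-nonNeg (λ i → Σ-nonNeg (λ j → x*x-nonNeg (M i j)))

infixl 7 _⊗ᵥ_
_⊗ᵥ_ : ∀ {n} → Matrix n → (Fin n → ℚ) → Fin n → ℚ
_⊗ᵥ_ {n} M x i = Σ[ n ] (λ k → M i k * x k)

quadForm : ∀ {n} → Matrix n → (Fin n → ℚ) → ℚ
quadForm {n} M x = Σ[ n ] (λ i → x i * (M ⊗ᵥ x) i)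

IsComplete : ∀ {n} → Graph n → Set
IsComplete {n} G = ∀ {u v : Fin n} → u ≢ v → adj G u v ≡ true

≅complete⇒isComplete : ∀ {n} {G : Graph n} → G ≅ complete n → IsComplete G
≅complete⇒isComplete {n} {G} (f , f-preserves) {u} {v} u≢v =
  trans (sym (f-preserves u v)) distinct-images
  where
  distinct-images : not (does (Bijection.to f u ≟ Bijection.to f v)) ≡ true
  distinct-images with Bijection.to f u ≟ Bijection.to f v
  ... | yes fu≡fv = ⊥-elim (u≢v (Bijection.injective f fu≡fv))
  ... | no _      = refl

isComplete⇒≅complete : ∀ {n} {G : Graph n} → IsComplete G → G ≅ complete n
isComplete⇒≅complete {n} {G} G-complete = ⤖-id (Fin n) , adj-complete
  where
  adj-complete : ∀ u v → not (does (u ≟ v)) ≡ adj G u v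
  adj-complete u v with u ≟ v
  ... | yes refl = sym (irrefl G u)
  ... | no u≢v   = sym (G-complete u≢v)

module Laplacian {n : ℕ} (G : Graph n) where

  A : Matrix n
  A i j = bit (adj G i j)

  L : Matrix n
  L = laplacian G

  A-sym : Symmetric A
  A-sym i j = cong bit (adj-sym G i j)

  L-sym : Symmetric L
  L-sym i j with i ≟ j | j ≟ i
  ... | yes refl | yes _    = refl
  ... | no _     | no _     = cong (λ a → 0ℚ - a) (A-sym i j)
  ... | yes i≡j  | no j≢i  = ⊥-elim (j≢i (sym i≡j))
  ... | no i≢j   | yes j≡i = ⊥-elim (i≢j (sym j≡i))

  L-apply : ∀ x i → (L ⊗ᵥ x) i ≡ Σ[ n ] (λ k → A i k * (x i - x k))
  L-apply x i = begin
    Σ[ n ] (λ k → L i k * x k)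
      ≡⟨ Σ-cong (λ k → diag-minus-* (does (i ≟ k)) (degree G i) (A i k) (x k)) ⟩
    Σ[ n ] (λ k → (if does (i ≟ k) then degree G i * x k else 0ℚ) - A i k * x k)
      ≡⟨ Σ-distrib-- _ (λ k → A i k * x k) ⟩
    Σ[ n ] (λ k → if does (i ≟ k) then degree G i * x k else 0ℚ) - Σ[ n ] (λ k → A i k * x k)
      ≡⟨ cong (_- Σ[ n ] (λ k → A i k * x k)) (Σ-select i (λ k → degree G i * x k)) ⟩
    degree G i * x i - Σ[ n ] (λ k → A i k * x k)
      ≡⟨ cong (_- Σ[ n ] (λ k → A i k * x k)) (*-distribʳ-Σ (x i) (A i)) ⟩
    Σ[ n ] (λ k → A i k * x i) - Σ[ n ] (λ k → A i k * x k)
      ≡⟨ Σ-distrib-- (λ k → A i k * x i) (λ k → A i k * x k) ⟨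
    Σ[ n ] (λ k → A i k * x i - A i k * x k)
      ≡⟨ Σ-cong (λ k → factor (A i k) (x i) (x k)) ⟩
    Σ[ n ] (λ k → A i k * (x i - x k))
      ∎
    where
    open ≡-Reasoning
    factor : ∀ a y z → a * y - a * z ≡ a * (y - z)
    factor = solve-∀ ℚ-ring
    diag-minus-* : ∀ b d a y → ((if b then d else 0ℚ) - a) * y ≡ (if b then d * y else 0ℚ) - a * y
    diag-minus-* true  = on-diagonal
      where
      on-diagonal : ∀ d a y → (d - a) * y ≡ d * y - a * y
      on-diagonal = solve-∀ ℚ-ring
    diag-minus-* false _ = off-diagonal
      where
      off-diagonal : ∀ a y → (0ℚ - a) * y ≡ 0ℚ - a * y
      off-diagonal = solve-∀ ℚ-ring

  L-rowSumsZero : RowSumsZero L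
  L-rowSumsZero i = begin
    Σ[ n ] (L i)                          ≡⟨ Σ-cong (λ k → sym (ℚ.*-identityʳ (L i k))) ⟩
    (L ⊗ᵥ (λ _ → 1ℚ)) i                  ≡⟨ L-apply (λ _ → 1ℚ) i ⟩
    Σ[ n ] (λ k → A i k * (1ℚ - 1ℚ))     ≡⟨ Σ-cong (λ k → ℚ.*-zeroʳ (A i k)) ⟩
    Σ[ n ] (λ _ → 0ℚ)                     ≡⟨ Σ-zero {n} ⟩
    0ℚ                                    ∎
    where open ≡-Reasoning

  L-colSumsZero : ColSumsZero L
  L-colSumsZero = symmetric-rowSumsZero⇒colSumsZero L-sym L-rowSumsZero

  edgeSquare : (Fin n → ℚ) → Fin n → Fin n → ℚ
  edgeSquare x a b = A a b * ((x a - x b) * (x a - x b))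

  edgeSquare-nonNeg : ∀ x a b → 0ℚ ≤ edgeSquare x a b
  edgeSquare-nonNeg x a b = *-nonNeg (bit-nonNeg (adj G a b)) (x*x-nonNeg (x a - x b))

  2*quadForm≡Σ-edgeSquare : ∀ x →
    (1ℚ + 1ℚ) * quadForm L x ≡ Σ[ n ] (λ a → Σ[ n ] (λ b → edgeSquare x a b))
  2*quadForm≡Σ-edgeSquare x = begin
    (1ℚ + 1ℚ) * quadForm L x                  ≡⟨ double (quadForm L x) ⟩
    quadForm L x + quadForm L x               ≡⟨ cong₂ _+_ Q≡Σt Q≡Σt′ ⟩
    Σ[ n ] (λ a → Σ[ n ] (t a)) + Σ[ n ] (λ a → Σ[ n ] (t′ a))
      ≡⟨ Σ-distrib-+ (λ a → Σ[ n ] (t a)) (λ a → Σ[ n ] (t′ a)) ⟨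
    Σ[ n ] (λ a → Σ[ n ] (t a) + Σ[ n ] (t′ a))
      ≡⟨ Σ-cong (λ a → Σ-distrib-+ (t a) (t′ a)) ⟨
    Σ[ n ] (λ a → Σ[ n ] (λ b → t a b + t′ a b))
      ≡⟨ Σ-cong (λ a → Σ-cong (λ b → square (A a b) (x a) (x b))) ⟩
    Σ[ n ] (λ a → Σ[ n ] (λ b → edgeSquare x a b))
      ∎
    where
    open ≡-Reasoning
    t t′ : Fin n → Fin n → ℚ
    t  a b = x a * (A a b * (x a - x b))
    t′ a b = A a b * (x b * (x b - x a))
    double : ∀ q → (1ℚ + 1ℚ) * q ≡ q + q
    double = solve-∀ ℚ-ring
    square : ∀ a y z → y * (a * (y - z)) + a * (z * (z - y)) ≡ a * ((y - z) * (y - z))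
    square = solve-∀ ℚ-ring
    rearrange : ∀ a y w → y * (a * w) ≡ a * (y * w)
    rearrange = solve-∀ ℚ-ring
    Q≡Σt : quadForm L x ≡ Σ[ n ] (λ a → Σ[ n ] (t a))
    Q≡Σt = Σ-cong (λ a → trans (cong (x a *_) (L-apply x a)) (*-distribˡ-Σ (x a) (λ b → A a b * (x a - x b))))
    Q≡Σt′ : quadForm L x ≡ Σ[ n ] (λ a → Σ[ n ] (t′ a))
    Q≡Σt′ = trans Q≡Σt (trans (Σ-comm t) (Σ-cong (λ a → Σ-cong (λ b →
      trans (cong (λ w → x b * (w * (x b - x a))) (A-sym b a)) (rearrange (A a b) (x b) (x b - x a))))))

  quadForm-nonNeg : ∀ x → 0ℚ ≤ quadForm L x
  quadForm-nonNeg x = subst (0ℚ ≤_) halve (*-nonNeg (ℚ.nonNegative⁻¹ ½) 0≤2*quadForm)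
    where
    0≤2*quadForm : 0ℚ ≤ (1ℚ + 1ℚ) * quadForm L x
    0≤2*quadForm = subst (0ℚ ≤_) (sym (2*quadForm≡Σ-edgeSquare x))
                         (Σ-nonNeg (λ a → Σ-nonNeg (edgeSquare-nonNeg x a)))
    halve : ½ * ((1ℚ + 1ℚ) * quadForm L x) ≡ quadForm L x
    halve = trans (sym (ℚ.*-assoc ½ (1ℚ + 1ℚ) (quadForm L x))) (ℚ.*-identityˡ (quadForm L x))

  quadForm≡0⇒reach-const : ∀ x → quadForm L x ≡ 0ℚ → ∀ {u v} → Reach G u v → x u ≡ x v
  quadForm≡0⇒reach-const x Q≡0 here = refl
  quadForm≡0⇒reach-const x Q≡0 (step {v} {w} u⇝v vw) =
    trans (quadForm≡0⇒reach-const x Q≡0 u⇝v) (x-y≡0⇒x≡y (x*x≡0⇒x≡0 (edgeSquare≡0-on-edge)))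
    where
    edgeSquare≡0 : ∀ a b → edgeSquare x a b ≡ 0ℚ
    edgeSquare≡0 = ΣΣ-nonNeg-≡0 (edgeSquare-nonNeg x)
      (trans (sym (2*quadForm≡Σ-edgeSquare x)) (cong ((1ℚ + 1ℚ) *_) Q≡0))
    edgeSquare≡0-on-edge : (x v - x w) * (x v - x w) ≡ 0ℚ
    edgeSquare≡0-on-edge = trans (sym (ℚ.*-identityˡ _))
      (subst (λ e → bit e * ((x v - x w) * (x v - x w)) ≡ 0ℚ) vw (edgeSquare≡0 v w))

  constant-on-kernel : Connected G → ∀ x → (∀ i → (L ⊗ᵥ x) i ≡ 0ℚ) → ∀ u v → x u ≡ x v
  constant-on-kernel connected x Lx≡0 u v = quadForm≡0⇒reach-const x xLx≡0 (connected u v)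
    where
    xLx≡0 : quadForm L x ≡ 0ℚ
    xLx≡0 = trans (Σ-cong (λ a → trans (cong (x a *_) (Lx≡0 a)) (ℚ.*-zeroʳ (x a)))) (Σ-zero {n})

  Ā : Matrix n
  Ā u v = bit (not (does (u ≟ v)) ∧ not (adj G u v))

  Ā≡1-I-A : ∀ u v → Ā u v ≡ 1ℚ - I u v - A u v
  Ā≡1-I-A u v with u ≟ v
  ... | yes refl rewrite irrefl G u = refl
  ... | no _ with adj G u v
  ...   | true  = refl
  ...   | false = refl

  Ā-nonNeg : ∀ u v → 0ℚ ≤ Ā u v
  Ā-nonNeg u v = bit-nonNeg (not (does (u ≟ v)) ∧ not (adj G u v))

  Ā-nonAdjacent : ∀ {u v} → u ≢ v → adj G u v ≡ false → Ā u v ≡ 1ℚ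
  Ā-nonAdjacent {u} {v} u≢v uv-nonadj with u ≟ v
  ... | yes u≡v = ⊥-elim (u≢v u≡v)
  ... | no _ rewrite uv-nonadj = refl

  module _ (G-complete : IsComplete G) where

    complete⇒A≡1-I : ∀ u v → A u v ≡ 1ℚ - I u v
    complete⇒A≡1-I u v with u ≟ v
    ... | yes refl rewrite irrefl G u = refl
    ... | no u≢v rewrite G-complete u≢v = refl

    complete⇒Ā≡0 : ∀ u v → Ā u v ≡ 0ℚ
    complete⇒Ā≡0 u v with u ≟ v
    ... | yes _ = refl
    ... | no u≢v rewrite G-complete u≢v = refl

module Centering (d : ℕ) where

  Nℚ : ℚ
  Nℚ = suc d · 1ℚ

  instance
    Nℚ-positive : Positive Nℚ
    Nℚ-positive = ℚ.pos+nonNeg⇒pos 1ℚ (d · 1ℚ) {{nonNegative (·1-nonNeg d)}}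

    Nℚ-nonZero : NonZeroℚ Nℚ
    Nℚ-nonZero = ℚ.pos⇒nonZero Nℚ

  ν : ℚ
  ν = 1/ Nℚ

  ν-nonNeg : 0ℚ ≤ ν
  ν-nonNeg = ℚ.nonNegative⁻¹ ν {{ℚ.pos⇒nonNeg ν {{ℚ.1/pos⇒pos Nℚ}}}}

  Nℚ*ν≡1 : Nℚ * ν ≡ 1ℚ
  Nℚ*ν≡1 = ℚ.*-inverseʳ Nℚ

  ν*[Nℚ*x]≡x : ∀ x → ν * (Nℚ * x) ≡ x
  ν*[Nℚ*x]≡x x = begin
    ν * (Nℚ * x)   ≡⟨ ℚ.*-assoc ν Nℚ x ⟨
    ν * Nℚ * x     ≡⟨ cong (_* x) (ℚ.*-inverseˡ Nℚ) ⟩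
    1ℚ * x         ≡⟨ ℚ.*-identityˡ x ⟩
    x              ∎
    where open ≡-Reasoning

  Nℚ*[ν*x]≡x : ∀ x → Nℚ * (ν * x) ≡ x
  Nℚ*[ν*x]≡x x = trans (sym (ℚ.*-assoc Nℚ ν x)) (trans (cong (_* x) Nℚ*ν≡1) (ℚ.*-identityˡ x))

  Σ-ν : Σ[ suc d ] (λ _ → ν) ≡ 1ℚ
  Σ-ν = trans (Σ-const {suc d} ν) Nℚ*ν≡1

  constant-sum≡1⇒≡ν : ∀ (c : Fin (suc d) → ℚ) c₀ → (∀ k → c k ≡ c₀) → Σ[ suc d ] c ≡ 1ℚ → c₀ ≡ ν
  constant-sum≡1⇒≡ν c c₀ c≡c₀ Σc≡1 = begin
    c₀                       ≡⟨ ν*[Nℚ*x]≡x c₀ ⟨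
    ν * (Nℚ * c₀)            ≡⟨ cong (ν *_) (trans (Σ-cong c≡c₀) (Σ-const {suc d} c₀)) ⟨
    ν * Σ[ suc d ] c         ≡⟨ cong (ν *_) Σc≡1 ⟩
    ν * 1ℚ                   ≡⟨ ℚ.*-identityʳ ν ⟩
    ν                        ∎
    where open ≡-Reasoning

  d/N≡d*ν : ℤ.+ d / suc d ≡ (d · 1ℚ) * ν
  d/N≡d*ν = begin
    ℤ.+ d / suc d                  ≡⟨ ν*[Nℚ*x]≡x (ℤ.+ d / suc d) ⟨
    ν * (Nℚ * (ℤ.+ d / suc d))     ≡⟨ cong (ν *_) Nℚ*[d/N]≡d ⟩
    ν * (d · 1ℚ)                   ≡⟨ ℚ.*-comm ν (d · 1ℚ) ⟩
    (d · 1ℚ) * ν                   ∎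
    where
    open ≡-Reasoning
    cross : ∀ x y → (x ℤ.* y) ℤ.* ℤ.+ 1 ≡ y ℤ.* (ℤ.+ 1 ℤ.* x)
    cross = ℤ-solve-∀
    Nℚ*[d/N]≡d : Nℚ * (ℤ.+ d / suc d) ≡ d · 1ℚ
    Nℚ*[d/N]≡d = ℚ.toℚᵘ-injective (ℚᵘ.≃-trans (ℚ.toℚᵘ-homo-* Nℚ (ℤ.+ d / suc d))
      (ℚᵘ.≃-trans (ℚᵘ.*-cong (toℚᵘ-·1 (suc d)) (ℚ.toℚᵘ-fromℚᵘ (ℚᵘ.mkℚᵘ (ℤ.+ d) d)))
      (ℚᵘ.≃-trans (ℚᵘ.*≡* (cross (ℤ.+ suc d) (ℤ.+ d))) (ℚᵘ.≃-sym (toℚᵘ-·1 d)))))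

  P : Matrix (suc d)
  P i j = I i j - ν

  P-sym : Symmetric P
  P-sym i j = cong (_- ν) (I-sym i j)

  P-rowSumsZero : RowSumsZero P
  P-rowSumsZero i = begin
    Σ[ suc d ] (λ j → I i j - ν)            ≡⟨ Σ-distrib-- (I i) (λ _ → ν) ⟩
    Σ[ suc d ] (I i) - Σ[ suc d ] (λ _ → ν)  ≡⟨ cong₂ _-_ (Σ-I i) Σ-ν ⟩
    1ℚ - 1ℚ                                  ≡⟨ ℚ.+-inverseʳ 1ℚ ⟩
    0ℚ                                       ∎
    where open ≡-Reasoning

  trace-P : trace P ≡ d · 1ℚ
  trace-P = begin
    Σ[ suc d ] (λ i → I i i - ν)   ≡⟨ Σ-cong {suc d} (λ i → cong (_- ν) (I-diag i)) ⟩
    Σ[ suc d ] (λ _ → 1ℚ - ν)      ≡⟨ Σ-const {suc d} (1ℚ - ν) ⟩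
    Nℚ * (1ℚ - ν)                  ≡⟨ distrib Nℚ ν ⟩
    Nℚ - Nℚ * ν                    ≡⟨ cong (λ s → Nℚ - s) Nℚ*ν≡1 ⟩
    1ℚ + d · 1ℚ - 1ℚ               ≡⟨ cancel (d · 1ℚ) ⟩
    d · 1ℚ                         ∎
    where
    open ≡-Reasoning
    distrib : ∀ x y → x * (1ℚ - y) ≡ x - x * y
    distrib = solve-∀ ℚ-ring
    cancel : ∀ x → 1ℚ + x - 1ℚ ≡ x
    cancel = solve-∀ ℚ-ring

  ⊗-P : ∀ (M : Matrix (suc d)) → RowSumsZero M → M ⊗ P ≐ M
  ⊗-P M ΣM≡0 i j = begin
    Σ[ suc d ] (λ k → M i k * (I k j - ν))
      ≡⟨ Σ-cong (λ k → expand (M i k) (I k j) ν) ⟩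
    Σ[ suc d ] (λ k → M i k * I k j - M i k * ν)
      ≡⟨ Σ-distrib-- (λ k → M i k * I k j) (λ k → M i k * ν) ⟩
    Σ[ suc d ] (λ k → M i k * I k j) - Σ[ suc d ] (λ k → M i k * ν)
      ≡⟨ cong₂ _-_ (Σ-*Iᵀ j (M i)) (sym (*-distribʳ-Σ ν (M i))) ⟩
    M i j - Σ[ suc d ] (M i) * ν
      ≡⟨ cong (λ s → M i j - s * ν) (ΣM≡0 i) ⟩
    M i j - 0ℚ * ν
      ≡⟨ vanish (M i j) ν ⟩
    M i j
      ∎
    where
    open ≡-Reasoning
    expand : ∀ m a y → m * (a - y) ≡ m * a - m * y
    expand = solve-∀ ℚ-ring
    vanish : ∀ m y → m - 0ℚ * y ≡ m
    vanish = solve-∀ ℚ-ring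

  Σ-*P-diag : ∀ (M : Matrix (suc d)) → RowSumsZero M → ∀ u → Σ[ suc d ] (λ k → M u k * P u k) ≡ M u u
  Σ-*P-diag M ΣM≡0 u = trans (Σ-cong (λ k → cong (M u k *_) (P-sym u k))) (⊗-P M ΣM≡0 u u)

  P-⊗ : ∀ (M : Matrix (suc d)) → ColSumsZero M → P ⊗ M ≐ M
  P-⊗ M ΣM≡0 i j = begin
    Σ[ suc d ] (λ k → (I i k - ν) * M k j)
      ≡⟨ Σ-cong (λ k → expand (I i k) ν (M k j)) ⟩
    Σ[ suc d ] (λ k → M k j * I i k - ν * M k j)
      ≡⟨ Σ-distrib-- (λ k → M k j * I i k) (λ k → ν * M k j) ⟩
    Σ[ suc d ] (λ k → M k j * I i k) - Σ[ suc d ] (λ k → ν * M k j)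
      ≡⟨ cong₂ _-_ (Σ-*I i (λ k → M k j)) (sym (*-distribˡ-Σ ν (λ k → M k j))) ⟩
    M i j - ν * Σ[ suc d ] (λ k → M k j)
      ≡⟨ cong (λ s → M i j - ν * s) (ΣM≡0 j) ⟩
    M i j - ν * 0ℚ
      ≡⟨ vanish (M i j) ν ⟩
    M i j
      ∎
    where
    open ≡-Reasoning
    expand : ∀ a y m → (a - y) * m ≡ m * a - y * m
    expand = solve-∀ ℚ-ring
    vanish : ∀ m y → m - y * 0ℚ ≡ m
    vanish = solve-∀ ℚ-ring

module PseudoInverse (d : ℕ) (G : Graph (suc d)) (connected : Connected G)
                     (X : Matrix (suc d)) (X-MP : IsMPInverse (laplacian G) X) where
  open Laplacian G
  open Centering d

  L⊗X⊗L≐L : (L ⊗ X) ⊗ L ≐ L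
  L⊗X⊗L≐L = proj₁ X-MP

  X⊗L⊗X≐X : (X ⊗ L) ⊗ X ≐ X
  X⊗L⊗X≐X = proj₁ (proj₂ X-MP)

  L⊗X-sym : ((L ⊗ X) ᵀ) ≐ (L ⊗ X)
  L⊗X-sym = proj₁ (proj₂ (proj₂ X-MP))

  X⊗L-sym : ((X ⊗ L) ᵀ) ≐ (X ⊗ L)
  X⊗L-sym = proj₂ (proj₂ (proj₂ X-MP))

  L⊗M≐L⇒M≐P : ∀ M → ColSumsZero M → L ⊗ M ≐ L → M ≐ P
  L⊗M≐L⇒M≐P M ΣM≡0 L⊗M≐L i j = begin
    M i j          ≡⟨ complement (M i j) (I i j) ⟩
    I i j - c i    ≡⟨ cong (λ x → I i j - x) (trans (c-constant i j) c≡ν) ⟩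
    I i j - ν      ∎
    where
    open ≡-Reasoning
    complement : ∀ m a → m ≡ a - (a - m)
    complement = solve-∀ ℚ-ring
    expand : ∀ l a m → l * (a - m) ≡ l * a - l * m
    expand = solve-∀ ℚ-ring
    c : Fin (suc d) → ℚ
    c k = I k j - M k j
    Lc≡0 : ∀ a → (L ⊗ᵥ c) a ≡ 0ℚ
    Lc≡0 a = begin
      Σ[ suc d ] (λ k → L a k * (I k j - M k j))
        ≡⟨ Σ-cong (λ k → expand (L a k) (I k j) (M k j)) ⟩
      Σ[ suc d ] (λ k → L a k * I k j - L a k * M k j)
        ≡⟨ Σ-distrib-- (λ k → L a k * I k j) (λ k → L a k * M k j) ⟩
      Σ[ suc d ] (λ k → L a k * I k j) - (L ⊗ M) a j
        ≡⟨ cong₂ _-_ (Σ-*Iᵀ j (L a)) (L⊗M≐L a j) ⟩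
      L a j - L a j
        ≡⟨ ℚ.+-inverseʳ (L a j) ⟩
      0ℚ ∎
    c-constant : ∀ u v → c u ≡ c v
    c-constant = constant-on-kernel connected c Lc≡0
    Σc≡1 : Σ[ suc d ] c ≡ 1ℚ
    Σc≡1 = trans (Σ-distrib-- (λ k → I k j) (λ k → M k j))
                 (cong₂ _-_ (trans (Σ-cong (λ k → I-sym k j)) (Σ-I j)) (ΣM≡0 j))
    c≡ν : c j ≡ ν
    c≡ν = constant-sum≡1⇒≡ν c (c j) (λ k → c-constant k j) Σc≡1

  L⊗X≐P : L ⊗ X ≐ P
  L⊗X≐P = L⊗M≐L⇒M≐P (L ⊗ X) (⊗-colSumsZero L X L-colSumsZero) L⊗L⊗X≐L
    where
    L⊗L⊗X≐L : L ⊗ (L ⊗ X) ≐ L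
    L⊗L⊗X≐L i j = begin
      Σ[ suc d ] (λ k → L i k * (L ⊗ X) k j)
        ≡⟨ Σ-cong (λ k → trans (cong₂ _*_ (L-sym i k) (sym (L⊗X-sym k j))) (ℚ.*-comm (L k i) ((L ⊗ X) j k))) ⟩
      ((L ⊗ X) ⊗ L) j i
        ≡⟨ L⊗X⊗L≐L j i ⟩
      L j i
        ≡⟨ L-sym j i ⟩
      L i j ∎
      where open ≡-Reasoning

  X⊗L≐P : X ⊗ L ≐ P
  X⊗L≐P = L⊗M≐L⇒M≐P (X ⊗ L) ΣX⊗L≡0 L⊗X⊗L≐L′
    where
    ΣX⊗L≡0 : ColSumsZero (X ⊗ L)
    ΣX⊗L≡0 j = trans (Σ-cong (λ i → sym (X⊗L-sym i j))) (⊗-rowSumsZero X L L-rowSumsZero j)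
    L⊗X⊗L≐L′ : L ⊗ (X ⊗ L) ≐ L
    L⊗X⊗L≐L′ i j = trans (sym (⊗-assoc L X L i j)) (L⊗X⊗L≐L i j)

  X≐X⊗P : X ≐ X ⊗ P
  X≐X⊗P i j = begin
    X i j              ≡⟨ X⊗L⊗X≐X i j ⟨
    ((X ⊗ L) ⊗ X) i j  ≡⟨ ⊗-assoc X L X i j ⟩
    (X ⊗ (L ⊗ X)) i j  ≡⟨ ⊗-cong {A = X} (λ _ _ → refl) L⊗X≐P i j ⟩
    (X ⊗ P) i j        ∎
    where open ≡-Reasoning

  X-rowSumsZero : RowSumsZero X
  X-rowSumsZero i = trans (Σ-cong (X≐X⊗P i)) (⊗-rowSumsZero X P P-rowSumsZero i)

  X-sym : Symmetric X
  X-sym i j = begin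
    X i j                   ≡⟨ X≐X⊗P i j ⟩
    (X ⊗ P) i j             ≡⟨ ⊗-cong {A = X} (λ _ _ → refl) P≐L⊗Xᵀ i j ⟩
    (X ⊗ (L ⊗ (X ᵀ))) i j   ≡⟨ ⊗-assoc X L (X ᵀ) i j ⟨
    ((X ⊗ L) ⊗ (X ᵀ)) i j   ≡⟨ ⊗-cong {B = X ᵀ} X⊗L≐P (λ _ _ → refl) i j ⟩
    (P ⊗ (X ᵀ)) i j         ≡⟨ P-⊗ (X ᵀ) X-rowSumsZero i j ⟩
    X j i                   ∎
    where
    open ≡-Reasoning
    P≐L⊗Xᵀ : P ≐ L ⊗ (X ᵀ)
    P≐L⊗Xᵀ k l = trans (sym (X⊗L≐P k l)) (trans (sym (X⊗L-sym k l))
      (Σ-cong (λ m → trans (ℚ.*-comm (X l m) (L m k)) (cong (_* X l m) (L-sym m k)))))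

  X-colSumsZero : ColSumsZero X
  X-colSumsZero = symmetric-rowSumsZero⇒colSumsZero X-sym X-rowSumsZero

module Resistance (d : ℕ) (G : Graph (suc d)) (connected : Connected G)
                  (X : Matrix (suc d)) (X-MP : IsMPInverse (laplacian G) X) where
  open Laplacian G
  open Centering d
  open PseudoInverse d G connected X X-MP

  resistance : Fin (suc d) → Fin (suc d) → ℚ
  resistance = gramDistance X

  potential : Fin (suc d) → Fin (suc d) → Fin (suc d) → ℚ
  potential u v a = X a u - X a v

  L⊗ᵥpotential : ∀ u v a → (L ⊗ᵥ potential u v) a ≡ I a u - I a v
  L⊗ᵥpotential u v a = begin
    Σ[ suc d ] (λ b → L a b * (X b u - X b v))
      ≡⟨ Σ-cong (λ b → expand (L a b) (X b u) (X b v)) ⟩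
    Σ[ suc d ] (λ b → L a b * X b u - L a b * X b v)
      ≡⟨ Σ-distrib-- (λ b → L a b * X b u) (λ b → L a b * X b v) ⟩
    (L ⊗ X) a u - (L ⊗ X) a v
      ≡⟨ cong₂ _-_ (L⊗X≐P a u) (L⊗X≐P a v) ⟩
    (I a u - ν) - (I a v - ν)
      ≡⟨ cancel (I a u) (I a v) ν ⟩
    I a u - I a v ∎
    where
    open ≡-Reasoning
    expand : ∀ l x y → l * (x - y) ≡ l * x - l * y
    expand = solve-∀ ℚ-ring
    cancel : ∀ x y z → (x - z) - (y - z) ≡ x - y
    cancel = solve-∀ ℚ-ring

  resistance≡quadForm : ∀ u v → resistance u v ≡ quadForm L (potential u v)
  resistance≡quadForm u v = sym (begin
    Σ[ suc d ] (λ a → w a * (L ⊗ᵥ w) a)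
      ≡⟨ Σ-cong (λ a → trans (cong (w a *_) (L⊗ᵥpotential u v a)) (expand (w a) (I a u) (I a v))) ⟩
    Σ[ suc d ] (λ a → w a * I a u - w a * I a v)
      ≡⟨ Σ-distrib-- (λ a → w a * I a u) (λ a → w a * I a v) ⟩
    Σ[ suc d ] (λ a → w a * I a u) - Σ[ suc d ] (λ a → w a * I a v)
      ≡⟨ cong₂ _-_ (Σ-*Iᵀ u w) (Σ-*Iᵀ v w) ⟩
    (X u u - X u v) - (X v u - X v v)
      ≡⟨ cong (λ x → (X u u - X u v) - (x - X v v)) (X-sym v u) ⟩
    (X u u - X u v) - (X u v - X v v)
      ≡⟨ collect (X u u) (X v v) (X u v) ⟩
    resistance u v ∎)
    where
    open ≡-Reasoning
    w : Fin (suc d) → ℚ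
    w = potential u v
    expand : ∀ x y z → x * (y - z) ≡ x * y - x * z
    expand = solve-∀ ℚ-ring
    collect : ∀ x y z → (x - z) - (z - y) ≡ x + y - (1ℚ + 1ℚ) * z
    collect = solve-∀ ℚ-ring

  resistance-nonNeg : ∀ u v → 0ℚ ≤ resistance u v
  resistance-nonNeg u v = subst (0ℚ ≤_) (sym (resistance≡quadForm u v)) (quadForm-nonNeg (potential u v))

  resistance-diag : ∀ u → resistance u u ≡ 0ℚ
  resistance-diag u = vanish (X u u)
    where
    vanish : ∀ x → x + x - (1ℚ + 1ℚ) * x ≡ 0ℚ
    vanish = solve-∀ ℚ-ring

  resistance≡0⇒≡ : ∀ {u v} → resistance u v ≡ 0ℚ → u ≡ v
  resistance≡0⇒≡ {u} {v} R≡0 with u ≟ v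
  ... | yes u≡v = u≡v
  ... | no u≢v = ⊥-elim (1≢0 (begin
    1ℚ                                    ≡⟨ cong₂ _-_ (I-diag u) (I-offDiag u≢v) ⟨
    I u u - I u v                         ≡⟨ L⊗ᵥpotential u v u ⟨
    Σ[ suc d ] (λ b → L u b * w b)        ≡⟨ Σ-cong (λ b → cong (L u b *_) (w-constant b u)) ⟩
    Σ[ suc d ] (λ b → L u b * w u)        ≡⟨ *-distribʳ-Σ (w u) (L u) ⟨
    Σ[ suc d ] (L u) * w u                ≡⟨ cong (_* w u) (L-rowSumsZero u) ⟩
    0ℚ * w u                              ≡⟨ ℚ.*-zeroˡ (w u) ⟩
    0ℚ                                    ∎))
    where
    open ≡-Reasoning
    1≢0 : 1ℚ ≢ 0ℚ
    1≢0 ()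
    w : Fin (suc d) → ℚ
    w = potential u v
    w-constant : ∀ a b → w a ≡ w b
    w-constant a b = quadForm≡0⇒reach-const w (trans (sym (resistance≡quadForm u v)) R≡0) (connected a b)

  -- Foster's theorem, with every edge counted in both orientations.
  Σ-A*resistance : Σ[ suc d ] (λ u → Σ[ suc d ] (λ v → A u v * resistance u v)) ≡ (1ℚ + 1ℚ) * (d · 1ℚ)
  Σ-A*resistance = begin
    Σ[ suc d ] (λ u → Σ[ suc d ] (λ v → A u v * resistance u v))
      ≡⟨ Σ-cong (λ u → trans (Σ-cong (split u)) (Σ-distrib-+ (t u) (λ v → t v u))) ⟩
    Σ[ suc d ] (λ u → Σ[ suc d ] (t u) + Σ[ suc d ] (λ v → t v u))
      ≡⟨ Σ-distrib-+ (λ u → Σ[ suc d ] (t u)) (λ u → Σ[ suc d ] (λ v → t v u)) ⟩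
    Σ[ suc d ] (λ u → Σ[ suc d ] (t u)) + Σ[ suc d ] (λ u → Σ[ suc d ] (λ v → t v u))
      ≡⟨ cong (Σ[ suc d ] (λ u → Σ[ suc d ] (t u)) +_) (Σ-comm (λ u v → t v u)) ⟩
    Σ[ suc d ] (λ u → Σ[ suc d ] (t u)) + Σ[ suc d ] (λ u → Σ[ suc d ] (t u))
      ≡⟨ cong₂ _+_ Σt≡d Σt≡d ⟩
    d · 1ℚ + d · 1ℚ
      ≡⟨ double (d · 1ℚ) ⟩
    (1ℚ + 1ℚ) * (d · 1ℚ) ∎
    where
    open ≡-Reasoning
    t : Fin (suc d) → Fin (suc d) → ℚ
    t u v = A u v * (X u u - X v u)
    double : ∀ x → x + x ≡ (1ℚ + 1ℚ) * x
    double = solve-∀ ℚ-ring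
    distrib : ∀ a x y z → a * (x + y - (1ℚ + 1ℚ) * z) ≡ a * (x - z) + a * (y - z)
    distrib = solve-∀ ℚ-ring
    split : ∀ u v → A u v * resistance u v ≡ t u v + t v u
    split u v = trans (distrib (A u v) (X u u) (X v v) (X u v))
                      (cong₂ (λ x a → A u v * (X u u - x) + a * (X v v - X u v)) (X-sym u v) (A-sym u v))
    Σt≡d : Σ[ suc d ] (λ u → Σ[ suc d ] (t u)) ≡ d · 1ℚ
    Σt≡d = trans (Σ-cong (λ u → trans (sym (L-apply (λ k → X k u) u)) (L⊗X≐P u u))) trace-P

  Σ-Ā*resistance : Σ[ suc d ] (λ u → Σ[ suc d ] (λ v → Ā u v * resistance u v))
                   ≡ (1ℚ + 1ℚ) * (Nℚ * trace X) - (1ℚ + 1ℚ) * (d · 1ℚ)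
  Σ-Ā*resistance = begin
    Σ[ suc d ] (λ u → Σ[ suc d ] (λ v → Ā u v * resistance u v))
      ≡⟨ Σ-cong row ⟩
    Σ[ suc d ] (λ u → Σ[ suc d ] (resistance u) - ΣAR u)
      ≡⟨ Σ-distrib-- (λ u → Σ[ suc d ] (resistance u)) ΣAR ⟩
    Σ[ suc d ] (λ u → Σ[ suc d ] (resistance u)) - Σ[ suc d ] ΣAR
      ≡⟨ cong₂ _-_ (Σ-gramDistance X X-rowSumsZero) Σ-A*resistance ⟩
    (1ℚ + 1ℚ) * (Nℚ * trace X) - (1ℚ + 1ℚ) * (d · 1ℚ) ∎
    where
    open ≡-Reasoning
    ΣAR : Fin (suc d) → ℚ
    ΣAR u = Σ[ suc d ] (λ v → A u v * resistance u v)
    expand : ∀ i a r → (1ℚ - i - a) * r ≡ r - r * i - a * r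
    expand = solve-∀ ℚ-ring
    drop-zero : ∀ x y → x - 0ℚ - y ≡ x - y
    drop-zero = solve-∀ ℚ-ring
    row : ∀ u → Σ[ suc d ] (λ v → Ā u v * resistance u v) ≡ Σ[ suc d ] (resistance u) - ΣAR u
    row u = begin
      Σ[ suc d ] (λ v → Ā u v * resistance u v)
        ≡⟨ Σ-cong (λ v → trans (cong (_* R v) (Ā≡1-I-A u v)) (expand (I u v) (A u v) (R v))) ⟩
      Σ[ suc d ] (λ v → R v - R v * I u v - A u v * R v)
        ≡⟨ Σ-distrib-- (λ v → R v - R v * I u v) (λ v → A u v * R v) ⟩
      Σ[ suc d ] (λ v → R v - R v * I u v) - ΣAR u
        ≡⟨ cong (_- ΣAR u) (Σ-distrib-- R (λ v → R v * I u v)) ⟩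
      Σ[ suc d ] R - Σ[ suc d ] (λ v → R v * I u v) - ΣAR u
        ≡⟨ cong (λ x → Σ[ suc d ] R - x - ΣAR u) (trans (Σ-*I u R) (resistance-diag u)) ⟩
      Σ[ suc d ] R - 0ℚ - ΣAR u
        ≡⟨ drop-zero (Σ[ suc d ] R) (ΣAR u) ⟩
      Σ[ suc d ] R - ΣAR u ∎
      where
      R : Fin (suc d) → ℚ
      R = resistance u

module Excess (d : ℕ) (G : Graph (suc d)) (connected : Connected G)
              (X : Matrix (suc d)) (X-MP : IsMPInverse (laplacian G) X) where
  open Laplacian G
  open Centering d
  open PseudoInverse d G connected X X-MP
  open Resistance d G connected X X-MP

  biharmonicIndex≡Nℚ*sqNorm : biharmonicIndex X ≡ Nℚ * sqNorm X
  biharmonicIndex≡Nℚ*sqNorm = begin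
    ½ * Σ[ suc d ] (λ u → Σ[ suc d ] (gramDistance (X ⊗ X) u))
      ≡⟨ cong (½ *_) (Σ-gramDistance (X ⊗ X) (⊗-rowSumsZero X X X-rowSumsZero)) ⟩
    ½ * ((1ℚ + 1ℚ) * (Nℚ * trace (X ⊗ X)))
      ≡⟨ halve (Nℚ * trace (X ⊗ X)) ⟩
    Nℚ * trace (X ⊗ X)
      ≡⟨ cong (Nℚ *_) (Σ-cong (λ u → Σ-cong (λ k → cong (X u k *_) (X-sym k u)))) ⟩
    Nℚ * sqNorm X ∎
    where
    open ≡-Reasoning
    halve : ∀ x → ½ * ((1ℚ + 1ℚ) * x) ≡ x
    halve x = trans (sym (ℚ.*-assoc ½ (1ℚ + 1ℚ) x)) (ℚ.*-identityˡ x)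

  deviation : Matrix (suc d)
  deviation u k = X u k - ν * P u k

  sqNorm-deviation : sqNorm deviation ≡ sqNorm X - (1ℚ + 1ℚ) * ν * trace X + ν * ν * (d · 1ℚ)
  sqNorm-deviation = begin
    Σ[ suc d ] (λ u → Σ[ suc d ] (λ k → deviation u k * deviation u k))
      ≡⟨ Σ-cong row ⟩
    Σ[ suc d ] (λ u → Σ[ suc d ] (λ k → X u k * X u k) - c * X u u + ν * ν * P u u)
      ≡⟨ Σ-distrib-+- (λ u → Σ[ suc d ] (λ k → X u k * X u k)) (λ u → c * X u u) (λ u → ν * ν * P u u) ⟩
    sqNorm X - Σ[ suc d ] (λ u → c * X u u) + Σ[ suc d ] (λ u → ν * ν * P u u)
      ≡⟨ cong₂ (λ a b → sqNorm X - a + b) (*-distribˡ-Σ c (λ u → X u u)) (*-distribˡ-Σ (ν * ν) (λ u → P u u)) ⟨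
    sqNorm X - c * trace X + ν * ν * trace P
      ≡⟨ cong (λ t → sqNorm X - c * trace X + ν * ν * t) trace-P ⟩
    sqNorm X - c * trace X + ν * ν * (d · 1ℚ) ∎
    where
    open ≡-Reasoning
    c : ℚ
    c = (1ℚ + 1ℚ) * ν
    square : ∀ x p v → (x - v * p) * (x - v * p) ≡ x * x - (1ℚ + 1ℚ) * v * (x * p) + v * v * (p * p)
    square = solve-∀ ℚ-ring
    row : ∀ u → Σ[ suc d ] (λ k → deviation u k * deviation u k)
              ≡ Σ[ suc d ] (λ k → X u k * X u k) - c * X u u + ν * ν * P u u
    row u = begin
      Σ[ suc d ] (λ k → deviation u k * deviation u k)
        ≡⟨ Σ-cong (λ k → square (X u k) (P u k) ν) ⟩
      Σ[ suc d ] (λ k → X u k * X u k - c * (X u k * P u k) + ν * ν * (P u k * P u k))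
        ≡⟨ Σ-distrib-+- (λ k → X u k * X u k) (λ k → c * (X u k * P u k)) (λ k → ν * ν * (P u k * P u k)) ⟩
      Σ[ suc d ] (λ k → X u k * X u k) - Σ[ suc d ] (λ k → c * (X u k * P u k))
        + Σ[ suc d ] (λ k → ν * ν * (P u k * P u k))
        ≡⟨ cong₂ (λ a b → Σ[ suc d ] (λ k → X u k * X u k) - a + b)
                 (*-distribˡ-Σ c (λ k → X u k * P u k)) (*-distribˡ-Σ (ν * ν) (λ k → P u k * P u k)) ⟨
      Σ[ suc d ] (λ k → X u k * X u k) - c * Σ[ suc d ] (λ k → X u k * P u k)
        + ν * ν * Σ[ suc d ] (λ k → P u k * P u k)
        ≡⟨ cong₂ (λ a b → Σ[ suc d ] (λ k → X u k * X u k) - c * a + ν * ν * b)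
                 (Σ-*P-diag X X-rowSumsZero u) (Σ-*P-diag P P-rowSumsZero u) ⟩
      Σ[ suc d ] (λ k → X u k * X u k) - c * X u u + ν * ν * P u u ∎

  nonEdgeResistance : ℚ
  nonEdgeResistance = Σ[ suc d ] (λ u → Σ[ suc d ] (λ v → Ā u v * resistance u v))

  excess : ℚ
  excess = Nℚ * sqNorm deviation + ν * nonEdgeResistance

  Ā*resistance-nonNeg : ∀ u v → 0ℚ ≤ Ā u v * resistance u v
  Ā*resistance-nonNeg u v = *-nonNeg (Ā-nonNeg u v) (resistance-nonNeg u v)

  Nℚ*sqNorm-nonNeg : 0ℚ ≤ Nℚ * sqNorm deviation
  Nℚ*sqNorm-nonNeg = *-nonNeg (·1-nonNeg (suc d)) (sqNorm-nonNeg deviation)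

  ν*nonEdgeResistance-nonNeg : 0ℚ ≤ ν * nonEdgeResistance
  ν*nonEdgeResistance-nonNeg = *-nonNeg ν-nonNeg (Σ-nonNeg (λ u → Σ-nonNeg (Ā*resistance-nonNeg u)))

  excess-nonNeg : 0ℚ ≤ excess
  excess-nonNeg = +-nonNeg Nℚ*sqNorm-nonNeg ν*nonEdgeResistance-nonNeg

  biharmonicIndex≡d/N+excess : biharmonicIndex X ≡ ℤ.+ d / suc d + excess
  biharmonicIndex≡d/N+excess = sym (begin
    ℤ.+ d / suc d + excess
      ≡⟨ cong₂ _+_ d/N≡d*ν (cong₂ (λ a b → Nℚ * a + ν * b) sqNorm-deviation Σ-Ā*resistance) ⟩
    m * ν + (Nℚ * (sqNorm X - (1ℚ + 1ℚ) * ν * s + ν * ν * m) + ν * ((1ℚ + 1ℚ) * (Nℚ * s) - (1ℚ + 1ℚ) * m))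
      ≡⟨ collect Nℚ ν (sqNorm X) s m ⟩
    Nℚ * sqNorm X + ν * m * (Nℚ * ν - 1ℚ)
      ≡⟨ cong (λ x → Nℚ * sqNorm X + ν * m * (x - 1ℚ)) Nℚ*ν≡1 ⟩
    Nℚ * sqNorm X + ν * m * (1ℚ - 1ℚ)
      ≡⟨ vanish (Nℚ * sqNorm X) (ν * m) ⟩
    Nℚ * sqNorm X
      ≡⟨ biharmonicIndex≡Nℚ*sqNorm ⟨
    biharmonicIndex X ∎)
    where
    open ≡-Reasoning
    m s : ℚ
    m = d · 1ℚ
    s = trace X
    collect : ∀ n v t s m →
      m * v + (n * (t - (1ℚ + 1ℚ) * v * s + v * v * m) + v * ((1ℚ + 1ℚ) * (n * s) - (1ℚ + 1ℚ) * m))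
      ≡ n * t + v * m * (n * v - 1ℚ)
    collect = solve-∀ ℚ-ring
    vanish : ∀ x y → x + y * (1ℚ - 1ℚ) ≡ x
    vanish = solve-∀ ℚ-ring

  d/N≤biharmonicIndex : ℤ.+ d / suc d ≤ biharmonicIndex X
  d/N≤biharmonicIndex = subst₂ _≤_ (ℚ.+-identityʳ (ℤ.+ d / suc d)) (sym biharmonicIndex≡d/N+excess)
                                   (ℚ.+-monoʳ-≤ (ℤ.+ d / suc d) excess-nonNeg)

  biharmonicIndex≡d/N⇒excess≡0 : biharmonicIndex X ≡ ℤ.+ d / suc d → excess ≡ 0ℚ
  biharmonicIndex≡d/N⇒excess≡0 B≡d/N =
    identityʳ-unique (ℤ.+ d / suc d) excess (trans (sym biharmonicIndex≡d/N+excess) B≡d/N)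

  excess≡0⇒biharmonicIndex≡d/N : excess ≡ 0ℚ → biharmonicIndex X ≡ ℤ.+ d / suc d
  excess≡0⇒biharmonicIndex≡d/N excess≡0 = begin
    biharmonicIndex X             ≡⟨ biharmonicIndex≡d/N+excess ⟩
    ℤ.+ d / suc d + excess        ≡⟨ cong (ℤ.+ d / suc d +_) excess≡0 ⟩
    ℤ.+ d / suc d + 0ℚ            ≡⟨ ℚ.+-identityʳ (ℤ.+ d / suc d) ⟩
    ℤ.+ d / suc d                 ∎
    where open ≡-Reasoning

  excess≡0⇒isComplete : excess ≡ 0ℚ → IsComplete G
  excess≡0⇒isComplete excess≡0 {u} {v} u≢v with adj G u v in uv
  ... | true  = refl
  ... | false = ⊥-elim (u≢v (resistance≡0⇒≡ resistance≡0))
    where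
    nonEdgeResistance≡0 : nonEdgeResistance ≡ 0ℚ
    nonEdgeResistance≡0 = begin
      nonEdgeResistance             ≡⟨ Nℚ*[ν*x]≡x nonEdgeResistance ⟨
      Nℚ * (ν * nonEdgeResistance)  ≡⟨ cong (Nℚ *_) (+-nonNeg-≡0ʳ Nℚ*sqNorm-nonNeg ν*nonEdgeResistance-nonNeg excess≡0) ⟩
      Nℚ * 0ℚ                       ≡⟨ ℚ.*-zeroʳ Nℚ ⟩
      0ℚ                            ∎
      where open ≡-Reasoning
    resistance≡0 : resistance u v ≡ 0ℚ
    resistance≡0 = begin
      resistance u v              ≡⟨ ℚ.*-identityˡ (resistance u v) ⟨
      1ℚ * resistance u v         ≡⟨ cong (_* resistance u v) (Ā-nonAdjacent u≢v uv) ⟨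
      Ā u v * resistance u v      ≡⟨ ΣΣ-nonNeg-≡0 Ā*resistance-nonNeg nonEdgeResistance≡0 u v ⟩
      0ℚ                          ∎
      where open ≡-Reasoning

  module _ (G-complete : IsComplete G) where

    complete⇒L≐Nℚ*P : ∀ i j → L i j ≡ Nℚ * P i j
    complete⇒L≐Nℚ*P i j = begin
      (if does (i ≟ j) then degree G i else 0ℚ) - A i j
        ≡⟨ cong₂ _-_ (sym (*-bit (does (i ≟ j)) (degree G i))) (complete⇒A≡1-I G-complete i j) ⟩
      degree G i * I i j - (1ℚ - I i j)
        ≡⟨ cong (λ x → x * I i j - (1ℚ - I i j)) degree≡d ⟩
      d · 1ℚ * I i j - (1ℚ - I i j)
        ≡⟨ regroup (d · 1ℚ) (I i j) ν ⟩
      Nℚ * (I i j - ν) + (Nℚ * ν - 1ℚ)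
        ≡⟨ cong (λ x → Nℚ * (I i j - ν) + (x - 1ℚ)) Nℚ*ν≡1 ⟩
      Nℚ * (I i j - ν) + (1ℚ - 1ℚ)
        ≡⟨ ℚ.+-identityʳ (Nℚ * (I i j - ν)) ⟩
      Nℚ * P i j ∎
      where
      open ≡-Reasoning
      regroup : ∀ m a v → m * a - (1ℚ - a) ≡ (1ℚ + m) * (a - v) + ((1ℚ + m) * v - 1ℚ)
      regroup = solve-∀ ℚ-ring
      cancel : ∀ m → (1ℚ + m) * 1ℚ - 1ℚ ≡ m
      cancel = solve-∀ ℚ-ring
      degree≡d : degree G i ≡ d · 1ℚ
      degree≡d = begin
        Σ[ suc d ] (A i)                          ≡⟨ Σ-cong (complete⇒A≡1-I G-complete i) ⟩
        Σ[ suc d ] (λ v → 1ℚ - I i v)             ≡⟨ Σ-distrib-- (λ _ → 1ℚ) (I i) ⟩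
        Σ[ suc d ] (λ _ → 1ℚ) - Σ[ suc d ] (I i)  ≡⟨ cong₂ _-_ (Σ-const {suc d} 1ℚ) (Σ-I i) ⟩
        Nℚ * 1ℚ - 1ℚ                              ≡⟨ cancel (d · 1ℚ) ⟩
        d · 1ℚ                                    ∎

    complete⇒X≐ν*P : ∀ i j → X i j ≡ ν * P i j
    complete⇒X≐ν*P i j = begin
      X i j                                            ≡⟨ ν*[Nℚ*x]≡x (X i j) ⟨
      ν * (Nℚ * X i j)                                 ≡⟨ cong (λ x → ν * (Nℚ * x)) (P-⊗ X X-colSumsZero i j) ⟨
      ν * (Nℚ * Σ[ suc d ] (λ k → P i k * X k j))      ≡⟨ cong (ν *_) (*-distribˡ-Σ Nℚ (λ k → P i k * X k j)) ⟩
      ν * Σ[ suc d ] (λ k → Nℚ * (P i k * X k j))      ≡⟨ cong (ν *_) (Σ-cong (λ k → sym (ℚ.*-assoc Nℚ (P i k) (X k j)))) ⟩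
      ν * Σ[ suc d ] (λ k → Nℚ * P i k * X k j)        ≡⟨ cong (ν *_) (Σ-cong (λ k → cong (_* X k j) (complete⇒L≐Nℚ*P i k))) ⟨
      ν * (L ⊗ X) i j                                  ≡⟨ cong (ν *_) (L⊗X≐P i j) ⟩
      ν * P i j                                        ∎
      where open ≡-Reasoning

    complete⇒excess≡0 : excess ≡ 0ℚ
    complete⇒excess≡0 = begin
      Nℚ * sqNorm deviation + ν * nonEdgeResistance
        ≡⟨ cong₂ (λ a b → Nℚ * a + ν * b) (ΣΣ-zero deviation²≡0) (ΣΣ-zero Ā*resistance≡0) ⟩
      Nℚ * 0ℚ + ν * 0ℚ
        ≡⟨ vanish Nℚ ν ⟩
      0ℚ ∎
      where
      open ≡-Reasoning
      vanish : ∀ a b → a * 0ℚ + b * 0ℚ ≡ 0ℚ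
      vanish = solve-∀ ℚ-ring
      ΣΣ-zero : {f : Fin (suc d) → Fin (suc d) → ℚ} → (∀ i j → f i j ≡ 0ℚ) →
                Σ[ suc d ] (λ i → Σ[ suc d ] (f i)) ≡ 0ℚ
      ΣΣ-zero f≡0 = trans (Σ-cong (λ i → trans (Σ-cong (f≡0 i)) (Σ-zero {suc d}))) (Σ-zero {suc d})
      deviation²≡0 : ∀ u k → deviation u k * deviation u k ≡ 0ℚ
      deviation²≡0 u k = trans (cong (λ x → (x - ν * P u k) * (x - ν * P u k)) (complete⇒X≐ν*P u k))
                               (cong (λ x → x * x) (ℚ.+-inverseʳ (ν * P u k)))
      Ā*resistance≡0 : ∀ u v → Ā u v * resistance u v ≡ 0ℚ
      Ā*resistance≡0 u v = trans (cong (_* resistance u v) (complete⇒Ā≡0 G-complete u v)) (ℚ.*-zeroˡ (resistance u v))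

theorem4p6 : (n : ℕ) → .{{_ : NonZero n}} → (G : Graph n) → Connected G →
    (Lp : Matrix n) → IsMPInverse (laplacian G) Lp →
    (((ℤ.+ (n ∸ 1)) / n) ≤ biharmonicIndex Lp)
      × ((biharmonicIndex Lp ≡ (ℤ.+ (n ∸ 1)) / n) ⇔ (G ≅ complete n))
theorem4p6 (suc d) G connected X X-MP =
    d/N≤biharmonicIndex
  , mk⇔ (λ B≡d/N → isComplete⇒≅complete {G = G} (excess≡0⇒isComplete (biharmonicIndex≡d/N⇒excess≡0 B≡d/N)))
        (λ G≅Kₙ → excess≡0⇒biharmonicIndex≡d/N (complete⇒excess≡0 (≅complete⇒isComplete {G = G} G≅Kₙ)))
  where open Excess d G connected X X-MP
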